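{- For every finite digraph $G$, $2^{\nu^*}\le\phi_m(G)$. More precisely, there exists a monotone Boolean network $f$ with interaction graph $G$ such that $f$ has at least $2^{\nu^*}$ fixed points and $f_v$ is the constant function $0$ for every source $v$ of $G$.
   Context: A Boolean network $f:\{0,1\}^n\to\{0,1\}^n$ is monotone if $x\le y\Rightarrow f(x)\le f(y)$; its interaction graph is the digraph on $[n]$ with arc $uv$ (loops allowed) iff $f_v$ depends on $x_u$; $\phi_m(G)$ is the maximum number of fixed points of a monotone Boolean network whose interaction graph is isomorphic to $G$. Cycles are directed without repeated vertices; paths are directed without repeated vertices except that first and last vertex may coincide; internal vertices of $v_0\dots v_\ell$ are $v_1,\dots,v_{\ell-1}$; a source is a vertex of in-degree $0$. A packing is a set of vertex-disjoint cycles $C_1,\dots,C_k$; a path is principal if none of its arcs and none of its internal vertices lies on a cycle of the packing; the packing is special if for every $C_i$ and vertex $v$ of $C_i$, the existence of a principal path from some $C_j\ne C_i$ to $v$ implies the existence of a principal path from $C_i$ or from a source to $v$ (possibly a cycle through $v$). $\nu^*$ is the maximum size of a special packing. -}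

module Defs where

open import Data.Nat using (ℕ)
open import Data.Fin using (Fin; _≟_)
open import Data.Bool using (Bool; true; false; not)
import Data.Bool as B
open import Data.List using (List; []; _∷_; _++_; [_])
open import Data.List.Membership.Propositional using (_∈_; _∉_)
open import Data.List.Relation.Unary.Unique.Propositional using (Unique)
open import Data.Product using (Σ; ∃; _×_; _,_)
open import Data.Sum using (_⊎_)
open import Data.Unit using (⊤)
open import Relation.Binary.PropositionalEquality using (_≡_; _≢_)
open import Relation.Nullary using (yes; no)
open import Function.Bundles using (_⇔_)

-- A finite digraph on vertex set Fin n (loops allowed): adjacency matrix.
Digraph : ℕ → Set
Digraph n = Fin n → Fin n → Bool

Arc : ∀ {n} → Digraph n → Fin n → Fin n → Set
Arc G u v = G u v ≡ true

IsSource : ∀ {n} → Digraph n → Fin n → Set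
IsSource G v = ∀ u → G u v ≡ false

Config : ℕ → Set
Config n = Fin n → Bool

BN : ℕ → Set
BN n = Config n → Config n

_≤ᶜ_ : ∀ {n} → Config n → Config n → Set
x ≤ᶜ y = ∀ i → x i B.≤ y i

Monotone : ∀ {n} → BN n → Set
Monotone f = ∀ x y → x ≤ᶜ y → f x ≤ᶜ f y

flipAt : ∀ {n} → Config n → Fin n → Config n
flipAt x u w with w ≟ u
... | yes _ = not (x w)
... | no  _ = x w

DependsOn : ∀ {n} → BN n → Fin n → Fin n → Set
DependsOn f u v = ∃ λ x → f x v ≢ f (flipAt x u) v

HasInteractionGraph : ∀ {n} → BN n → Digraph n → Set
HasInteractionGraph f G = ∀ u v → (Arc G u v ⇔ DependsOn f u v)

IsFixedPoint : ∀ {n} → BN n → Config n → Set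
IsFixedPoint f x = ∀ v → f x v ≡ x v

AtLeastFixedPoints : ∀ {n} → BN n → ℕ → Set
AtLeastFixedPoints {n} f m =
  Σ (Fin m → Config n) λ g →
    (∀ i → IsFixedPoint f (g i)) × (∀ i j → (∀ v → g i v ≡ g j v) → i ≡ j)

Chain : ∀ {n} → Digraph n → List (Fin n) → Set
Chain G [] = ⊤
Chain G (x ∷ []) = ⊤
Chain G (x ∷ y ∷ r) = Arc G x y × Chain G (y ∷ r)

arcsOf : ∀ {a} {A : Set a} → List A → List (A × A)
arcsOf [] = []
arcsOf (x ∷ []) = []
arcsOf (x ∷ y ∷ r) = (x , y) ∷ arcsOf (y ∷ r)

-- A cycle start → r₁ → … → r_m → start with distinct vertices (m ≥ 0; m = 0 is a loop).
record Cycle {n} (G : Digraph n) : Set where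
  field
    start    : Fin n
    rest     : List (Fin n)
    distinct : Unique (start ∷ rest)
    closed   : Chain G (start ∷ rest ++ [ start ])

cycVerts : ∀ {n} {G : Digraph n} → Cycle G → List (Fin n)
cycVerts C = Cycle.start C ∷ Cycle.rest C

cycArcs : ∀ {n} {G : Digraph n} → Cycle G → List (Fin n × Fin n)
cycArcs C = arcsOf (Cycle.start C ∷ Cycle.rest C ++ [ Cycle.start C ])

-- A path src = v₀ → v₁ → … → v_ℓ = tgt with ℓ ≥ 1, internal vertices v₁ … v_{ℓ-1};
-- no repeated vertex except that v₀ and v_ℓ may coincide.
record Path {n} (G : Digraph n) : Set where
  field
    src      : Fin n
    internal : List (Fin n)
    tgt      : Fin n
    chain    : Chain G (src ∷ internal ++ [ tgt ])
    uniqInit : Unique (src ∷ internal)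
    uniqTail : Unique (internal ++ [ tgt ])

pathArcs : ∀ {n} {G : Digraph n} → Path G → List (Fin n × Fin n)
pathArcs P = arcsOf (Path.src P ∷ Path.internal P ++ [ Path.tgt P ])

record Packing {n} (G : Digraph n) (k : ℕ) : Set where
  field
    cyc      : Fin k → Cycle G
    disjoint : ∀ i j → i ≢ j → ∀ v → v ∈ cycVerts (cyc i) → v ∉ cycVerts (cyc j)

Principal : ∀ {n} {G : Digraph n} {k} → Packing G k → Path G → Set
Principal Pk P = ∀ i →
  (∀ a → a ∈ pathArcs P → a ∉ cycArcs (Packing.cyc Pk i)) ×
  (∀ w → w ∈ Path.internal P → w ∉ cycVerts (Packing.cyc Pk i))

Special : ∀ {n} {G : Digraph n} {k} → Packing G k → Set
Special {G = G} Pk = ∀ i v → v ∈ cycVerts (Packing.cyc Pk i) →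
  (Σ _ λ j → j ≢ i × Σ (Path G) λ P →
     Principal Pk P × Path.src P ∈ cycVerts (Packing.cyc Pk j) × Path.tgt P ≡ v) →
  Σ (Path G) λ P → Principal Pk P × Path.tgt P ≡ v ×
     (Path.src P ∈ cycVerts (Packing.cyc Pk i) ⊎ IsSource G (Path.src P))

IsNuStar : ∀ {n} → Digraph n → ℕ → Set
IsNuStar G k =
  (Σ (Packing G k) Special) ×
  (∀ k′ → (Pk : Packing G k′) → Special Pk → k′ Data.Nat.≤ k)

module Submission where

-- Let v be a vertex of the packing with cycle predecessor p. The network sets
-- f_v(x) = x_p ∨ ⋀{x_u : u → v, u ≠ p}, and every other vertex takes the conjunction of its
-- in-neighbours (false at a source); this is monotone with interaction graph G. For a set S of
-- packing cycles, iterating f from the indicator of the cycles in S increases to a fixed point.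
-- Along the iteration, ones occur only on S-cycles or at vertices reached by a principal path
-- from them, while the other cycles, the sources, and every outside vertex reached principally
-- from those stay zero: a cycle vertex of a non-S cycle all of whose other in-neighbours are one
-- would receive a principal path from an S-cycle, and specialness then supplies a principal path
-- from its own cycle or a source whose vertex before v is zero. So the fixed point restricted to the
-- cycles is S, and the 2^k choices of S give distinct fixed points.

open import Defs
open import Data.Bool using (Bool; true; false; not; _∧_; _∨_; _≤_; b≤b)
import Data.Bool.Properties as BP
open import Data.Empty using (⊥; ⊥-elim)
open import Data.Fin using (Fin; zero; suc; _≟_; combine; finToFun; funToFin)
open import Data.Fin.Properties using (all?; any?; ¬∀⟶∃¬; 2↔Bool; funToFin-finToFin)
open import Data.List using (List; []; _∷_; _++_; [_]; _∷ʳ_; initLast; _∷ʳ′_)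
import Data.List.Properties as LP
open import Data.List.Membership.Propositional using (_∈_; _∉_)
open import Data.List.Membership.Propositional.Properties using (∈-++⁺ˡ; ∈-++⁺ʳ; ∈-++⁻; ∈-∃++)
open import Data.List.Relation.Binary.Subset.Propositional using (_⊆_)
open import Data.List.Relation.Unary.Any using (here; there)
open import Data.List.Relation.Unary.All using ([]; _∷_)
import Data.List.Relation.Unary.All.Properties as AllP
open import Data.List.Relation.Unary.AllPairs using ([]; _∷_)
open import Data.List.Relation.Unary.Unique.Propositional using (Unique)
import Data.List.Relation.Unary.Unique.Propositional.Properties as UniqueP
open import Data.Nat as ℕ using (ℕ; zero; suc; s≤s; z≤n; _^_)
import Data.Nat.Properties as ℕP
open import Data.Nat.GeneralisedArithmetic using (fold)
open import Data.Product as Prod using (Σ; ∃; _×_; _,_; proj₁; proj₂)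
open import Data.Product.Properties using (≡-dec)
open import Data.Sum using (_⊎_; inj₁; inj₂)
open import Data.Unit using (tt)
open import Function using (_∘_)
open import Function.Bundles using (mk⇔; Inverse; Injection)
open import Function.Properties.Inverse using (↔⇒↣)
open import Relation.Binary.PropositionalEquality
  using (_≡_; _≢_; refl; sym; trans; cong; cong₂; subst; module ≡-Reasoning)
open import Relation.Nullary using (yes; no; Dec; does; ¬_)
open import Relation.Nullary.Decidable using (_×-dec_; dec-true; dec-false)

∧-mono : ∀ {a b c d} → a ≤ b → c ≤ d → a ∧ c ≤ b ∧ d
∧-mono {false} _ _ = BP.≤-minimum _
∧-mono {true} b≤b c≤d = c≤d

∨-mono : ∀ {a b c d} → a ≤ b → c ≤ d → a ∨ c ≤ b ∨ d
∨-mono {true} b≤b _ = b≤b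
∨-mono {false} {false} _ c≤d = c≤d
∨-mono {false} {true} _ _ = BP.≤-maximum _

infixr 4 _⇒_
_⇒_ : Bool → Bool → Bool
true  ⇒ b = b
false ⇒ _ = true

⇒-monoʳ : ∀ a {b c} → b ≤ c → (a ⇒ b) ≤ (a ⇒ c)
⇒-monoʳ true  b≤c = b≤c
⇒-monoʳ false _   = b≤b

≢-by : ∀ {a b} → a ≡ true → b ≡ false → a ≢ b
≢-by refl refl ()

≤-true : ∀ {a b} → a ≤ b → a ≡ true → b ≡ true
≤-true b≤b refl = refl

⋀ : ∀ {m} → (Fin m → Bool) → Bool
⋀ {zero} _ = true
⋀ {suc m} P = P zero ∧ ⋀ (P ∘ suc)

⋁ : ∀ {m} → (Fin m → Bool) → Bool
⋁ {zero} _ = false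
⋁ {suc m} P = P zero ∨ ⋁ (P ∘ suc)

⋀-true⁻ : ∀ {m} (P : Fin m → Bool) → ⋀ P ≡ true → ∀ i → P i ≡ true
⋀-true⁻ P e zero = BP.∧-conicalˡ _ _ e
⋀-true⁻ P e (suc i) = ⋀-true⁻ (P ∘ suc) (BP.∧-conicalʳ _ _ e) i

⋀-true⁺ : ∀ {m} (P : Fin m → Bool) → (∀ i → P i ≡ true) → ⋀ P ≡ true
⋀-true⁺ {zero} P h = refl
⋀-true⁺ {suc m} P h = cong₂ _∧_ (h zero) (⋀-true⁺ (P ∘ suc) (h ∘ suc))

⋀-false⁺ : ∀ {m} (P : Fin m → Bool) i → P i ≡ false → ⋀ P ≡ false
⋀-false⁺ P zero e = cong (_∧ ⋀ (P ∘ suc)) e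
⋀-false⁺ P (suc i) e = trans (cong (P zero ∧_) (⋀-false⁺ (P ∘ suc) i e)) (BP.∧-zeroʳ _)

⋀-mono : ∀ {m} (P Q : Fin m → Bool) → (∀ i → P i ≤ Q i) → ⋀ P ≤ ⋀ Q
⋀-mono {zero} P Q h = b≤b
⋀-mono {suc m} P Q h = ∧-mono (h zero) (⋀-mono (P ∘ suc) (Q ∘ suc) (h ∘ suc))

⋀-cong : ∀ {m} (P Q : Fin m → Bool) → (∀ i → P i ≡ Q i) → ⋀ P ≡ ⋀ Q
⋀-cong {zero} P Q h = refl
⋀-cong {suc m} P Q h = cong₂ _∧_ (h zero) (⋀-cong (P ∘ suc) (Q ∘ suc) (h ∘ suc))

⋁-true⁻ : ∀ {m} (P : Fin m → Bool) → ⋁ P ≡ true → ∃ λ i → P i ≡ true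
⋁-true⁻ {suc m} P e with P zero in eq
... | true = zero , eq
... | false with ⋁-true⁻ (P ∘ suc) e
...   | i , q = suc i , q

⋁-true⁺ : ∀ {m} (P : Fin m → Bool) i → P i ≡ true → ⋁ P ≡ true
⋁-true⁺ P zero e = cong (_∨ ⋁ (P ∘ suc)) e
⋁-true⁺ P (suc i) e = trans (cong (P zero ∨_) (⋁-true⁺ (P ∘ suc) i e)) (BP.∨-zeroʳ _)

⋁-false⁺ : ∀ {m} (P : Fin m → Bool) → (∀ i → P i ≡ false) → ⋁ P ≡ false
⋁-false⁺ {zero} P h = refl
⋁-false⁺ {suc m} P h = cong₂ _∨_ (h zero) (⋁-false⁺ (P ∘ suc) (h ∘ suc))

-- The conjunction of x over the set N, taken to be false when N is empty.
⋀[_]_ : ∀ {m} → (Fin m → Bool) → (Fin m → Bool) → Bool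
⋀[ N ] x = ⋁ N ∧ ⋀ (λ w → N w ⇒ x w)

module _ {m : ℕ} (N : Fin m → Bool) where

  ⋀[]-true⁻ : ∀ {x} → ⋀[ N ] x ≡ true → (∃ λ w → N w ≡ true) × (∀ w → N w ≡ true → x w ≡ true)
  ⋀[]-true⁻ {x} e = ⋁-true⁻ N (BP.∧-conicalˡ _ _ e) , member
    where
    member : ∀ w → N w ≡ true → x w ≡ true
    member w Nw with ⋀-true⁻ (λ w → N w ⇒ x w) (BP.∧-conicalʳ _ _ e) w
    ... | Nw⇒xw rewrite Nw = Nw⇒xw

  ⋀[]-true⁺ : ∀ {x} w → N w ≡ true → (∀ w → N w ≡ true → x w ≡ true) → ⋀[ N ] x ≡ true
  ⋀[]-true⁺ {x} w Nw h = cong₂ _∧_ (⋁-true⁺ N w Nw) (⋀-true⁺ _ imp)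
    where
    imp : ∀ w → (N w ⇒ x w) ≡ true
    imp w with N w in Nw
    ... | true  = h w Nw
    ... | false = refl

  ⋀[]-false⁺ : ∀ {x} w → N w ≡ true → x w ≡ false → ⋀[ N ] x ≡ false
  ⋀[]-false⁺ {x} w Nw xw =
    trans (cong (⋁ N ∧_) (⋀-false⁺ (λ w → N w ⇒ x w) w (trans (cong (_⇒ x w) Nw) xw))) (BP.∧-zeroʳ _)

  ⋀[]-empty : ∀ {x} → (∀ w → N w ≡ false) → ⋀[ N ] x ≡ false
  ⋀[]-empty {x} empty = cong (_∧ ⋀ (λ w → N w ⇒ x w)) (⋁-false⁺ N empty)

  ⋀[]-const-false : ⋀[ N ] (λ _ → false) ≡ false
  ⋀[]-const-false with ⋁ N in e
  ... | false = refl
  ... | true with ⋁-true⁻ N e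
  ...   | w , Nw = ⋀-false⁺ (λ w → N w ⇒ false) w (cong (_⇒ false) Nw)

  ⋀[]-mono : ∀ {x y} → x ≤ᶜ y → ⋀[ N ] x ≤ ⋀[ N ] y
  ⋀[]-mono x≤y = ∧-mono b≤b (⋀-mono _ _ (λ w → ⇒-monoʳ (N w) (x≤y w)))

  ⋀[]-local : ∀ {x y} → (∀ w → N w ≡ true → x w ≡ y w) → ⋀[ N ] x ≡ ⋀[ N ] y
  ⋀[]-local {x} {y} h = cong (⋁ N ∧_) (⋀-cong _ _ agree)
    where
    agree : ∀ w → (N w ⇒ x w) ≡ (N w ⇒ y w)
    agree w with N w in Nw
    ... | true  = h w Nw
    ... | false = refl

≤∧≢⇒f<t : ∀ {a b} → a ≤ b → a ≢ b → a ≡ false × b ≡ true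
≤∧≢⇒f<t {false} {true} _ _ = refl , refl
≤∧≢⇒f<t b≤b a≢a = ⊥-elim (a≢a refl)

ones : ∀ {m} → (Fin m → Bool) → ℕ
ones {zero} _ = 0
ones {suc m} x with x zero
... | false = ones (x ∘ suc)
... | true  = suc (ones (x ∘ suc))

ones-≤ : ∀ {m} (x : Fin m → Bool) → ones x ℕ.≤ m
ones-≤ {zero} x = z≤n
ones-≤ {suc m} x with x zero
... | false = ℕP.m≤n⇒m≤1+n (ones-≤ (x ∘ suc))
... | true  = s≤s (ones-≤ (x ∘ suc))

ones-mono : ∀ {m} {x y : Fin m → Bool} → x ≤ᶜ y → ones x ℕ.≤ ones y
ones-mono {zero} _ = z≤n
ones-mono {suc m} {x} {y} x≤y with x zero | y zero | x≤y zero
... | false | false | _ = ones-mono (x≤y ∘ suc)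
... | false | true  | _ = ℕP.m≤n⇒m≤1+n (ones-mono (x≤y ∘ suc))
... | true  | true  | _ = s≤s (ones-mono (x≤y ∘ suc))

ones-< : ∀ {m} {x y : Fin m → Bool} → x ≤ᶜ y → ∀ v → x v ≡ false → y v ≡ true → ones x ℕ.< ones y
ones-< {suc m} {x} {y} x≤y zero xv yv rewrite xv | yv = s≤s (ones-mono (x≤y ∘ suc))
ones-< {suc m} {x} {y} x≤y (suc v) xv yv with x zero | y zero | x≤y zero
... | false | false | _ = ones-< (x≤y ∘ suc) v xv yv
... | false | true  | _ = ℕP.m≤n⇒m≤1+n (ones-< (x≤y ∘ suc) v xv yv)
... | true  | true  | _ = s≤s (ones-< (x≤y ∘ suc) v xv yv)

monotone-cong : ∀ {n} {f : BN n} → Monotone f → ∀ {y z} → (∀ v → y v ≡ z v) → ∀ v → f y v ≡ f z v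
monotone-cong {f = f} f-mono {y} {z} y≗z v =
  BP.≤-antisym (f-mono y z (≡⇒≤ y≗z) v) (f-mono z y (≡⇒≤ (sym ∘ y≗z)) v)
  where
  ≡⇒≤ : ∀ {a b : Config _} → (∀ v → a v ≡ b v) → a ≤ᶜ b
  ≡⇒≤ a≗b v rewrite a≗b v = b≤b

module Kleene {n : ℕ} (f : BN n) (f-mono : Monotone f) {x : Config n} (x≤fx : x ≤ᶜ f x) where

  iterate-post : ∀ t → fold x f t ≤ᶜ f (fold x f t)
  iterate-post zero = x≤fx
  iterate-post (suc t) = f-mono _ _ (iterate-post t)

  iterate-≥ : ∀ t → x ≤ᶜ fold x f t
  iterate-≥ zero v = b≤b
  iterate-≥ (suc t) v = BP.≤-trans (iterate-≥ t v) (iterate-post t v)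

  -- Each non-stationary step switches at least one more coordinate on.
  iterate-fixed⊎ones : ∀ t → IsFixedPoint f (fold x f t) ⊎ t ℕ.≤ ones (fold x f t)
  iterate-fixed⊎ones zero = inj₂ z≤n
  iterate-fixed⊎ones (suc t) with all? (λ v → f (fold x f t) v BP.≟ fold x f t v)
  ... | yes fixed = inj₁ (monotone-cong f-mono fixed)
  ... | no ¬fixed with iterate-fixed⊎ones t
  ...   | inj₁ fixed = ⊥-elim (¬fixed fixed)
  ...   | inj₂ t≤ones with ¬∀⟶∃¬ n _ (λ v → f (fold x f t) v BP.≟ fold x f t v) ¬fixed
  ...     | v , moved with ≤∧≢⇒f<t (iterate-post t v) (moved ∘ sym)
  ...       | off , on = inj₂ (ℕP.<-≤-trans (s≤s t≤ones) (ones-< (iterate-post t) v off on))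

  iterate-fixed : IsFixedPoint f (fold x f (suc n))
  iterate-fixed with iterate-fixed⊎ones (suc n)
  ... | inj₁ fixed = fixed
  ... | inj₂ n<ones = ⊥-elim (ℕP.<-irrefl refl (ℕP.<-≤-trans n<ones (ones-≤ _)))

module _ {A : Set} where

  arcsOf-∈ : ∀ (xs : List A) {a b} → (a , b) ∈ arcsOf xs → a ∈ xs × b ∈ xs
  arcsOf-∈ (x ∷ y ∷ r) (here refl) = here refl , there (here refl)
  arcsOf-∈ (x ∷ y ∷ r) (there m) = Prod.map there there (arcsOf-∈ (y ∷ r) m)

  arcsOf-++⁺ˡ : ∀ (xs : List A) {ys} → arcsOf xs ⊆ arcsOf (xs ++ ys)
  arcsOf-++⁺ˡ (x ∷ y ∷ r) (here refl) = here refl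
  arcsOf-++⁺ˡ (x ∷ y ∷ r) (there m) = there (arcsOf-++⁺ˡ (y ∷ r) m)

  arcsOf-∷ʳ : ∀ (xs : List A) t w → arcsOf (xs ∷ʳ t ∷ʳ w) ≡ arcsOf (xs ∷ʳ t) ∷ʳ (t , w)
  arcsOf-∷ʳ [] t w = refl
  arcsOf-∷ʳ (x ∷ []) t w = refl
  arcsOf-∷ʳ (x ∷ y ∷ r) t w = cong ((x , y) ∷_) (arcsOf-∷ʳ (y ∷ r) t w)

  arcsOf-into : ∀ (x : A) ys {y} → y ∈ ys → ∃ λ a → (a , y) ∈ arcsOf (x ∷ ys)
  arcsOf-into x (z ∷ zs) (here refl) = x , here refl
  arcsOf-into x (z ∷ zs) (there m) = Prod.map₂ there (arcsOf-into z zs m)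

  ∷ʳ⊆∷ : ∀ {xs : List A} {x} → xs ∷ʳ x ⊆ x ∷ xs
  ∷ʳ⊆∷ {xs} m with ∈-++⁻ xs m
  ... | inj₁ m′ = there m′
  ... | inj₂ (here refl) = here refl

  ∷⊆∷ʳ : ∀ {xs : List A} {x} → x ∷ xs ⊆ xs ∷ʳ x
  ∷⊆∷ʳ (here refl) = ∈-++⁺ʳ _ (here refl)
  ∷⊆∷ʳ (there m) = ∈-++⁺ˡ m

  Unique-++⁻ˡ : ∀ (xs : List A) {ys} → Unique (xs ++ ys) → Unique xs
  Unique-++⁻ˡ [] _ = []
  Unique-++⁻ˡ (x ∷ xs) (x∉ ∷ u) = AllP.++⁻ˡ xs x∉ ∷ Unique-++⁻ˡ xs u

  Unique-∷ʳ : ∀ {xs : List A} {x} → Unique xs → x ∉ xs → Unique (xs ∷ʳ x)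
  Unique-∷ʳ u x∉ = UniqueP.++⁺ u ([] ∷ []) (λ { (m , here refl) → x∉ m })

module Walks {n : ℕ} (G : Digraph n) where

  open import Data.List.Membership.DecPropositional (_≟_ {n}) using (_∈?_)

  chain-arc : ∀ xs → Chain G xs → ∀ {a b} → (a , b) ∈ arcsOf xs → Arc G a b
  chain-arc (x ∷ y ∷ r) (xy , _) (here refl) = xy
  chain-arc (x ∷ y ∷ r) (_ , c) (there m) = chain-arc (y ∷ r) c m

  chain-++⁻ˡ : ∀ xs {ys} → Chain G (xs ++ ys) → Chain G xs
  chain-++⁻ˡ [] _ = tt
  chain-++⁻ˡ (x ∷ []) _ = tt
  chain-++⁻ˡ (x ∷ y ∷ r) (xy , c) = xy , chain-++⁻ˡ (y ∷ r) c

  chain-∷ʳ : ∀ xs {t w} → Chain G (xs ∷ʳ t) → Arc G t w → Chain G (xs ∷ʳ t ∷ʳ w)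
  chain-∷ʳ [] _ tw = tw , tt
  chain-∷ʳ (x ∷ []) (xt , _) tw = xt , tw , tt
  chain-∷ʳ (x ∷ y ∷ r) (xy , c) tw = xy , chain-∷ʳ (y ∷ r) c tw

  module _ (C : Cycle G) where
    open Cycle C

    cycArc-arc : ∀ {a b} → (a , b) ∈ cycArcs C → Arc G a b
    cycArc-arc = chain-arc _ closed

    cycArc-verts : ∀ {a b} → (a , b) ∈ cycArcs C → a ∈ cycVerts C × b ∈ cycVerts C
    cycArc-verts m = Prod.map close close (arcsOf-∈ _ m)
      where
      close : ∀ {v} → v ∈ start ∷ rest ∷ʳ start → v ∈ start ∷ rest
      close m with ∈-++⁻ (start ∷ rest) m
      ... | inj₁ m′ = m′
      ... | inj₂ (here refl) = here refl

    cycVerts-pred : ∀ {v} → v ∈ cycVerts C → ∃ λ a → (a , v) ∈ cycArcs C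
    cycVerts-pred m = arcsOf-into start (rest ∷ʳ start) (∷⊆∷ʳ m)

  _⊑_ : Path G → Path G → Set
  Q ⊑ P = pathArcs Q ⊆ pathArcs P × Path.internal Q ⊆ Path.internal P

  arcPath : ∀ {u w} → Arc G u w → Path G
  arcPath {u} {w} uw = record
    { src = u ; internal = [] ; tgt = w ; chain = uw , tt ; uniqInit = [] ∷ [] ; uniqTail = [] ∷ [] }

  prefix : (P : Path G) {A : List (Fin n)} {w : Fin n} {B : List (Fin n)} →
    Path.internal P ≡ A ++ w ∷ B →
    Σ (Path G) λ Q → Path.src Q ≡ Path.src P × Path.tgt Q ≡ w × Q ⊑ P
  prefix record { src = s ; tgt = t ; chain = c ; uniqInit = ui ; uniqTail = ut } {A} {w} {B} refl =
    Q , refl , refl , arcs⊆ , ∈-++⁺ˡ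
    where
    reassoc : (A ++ w ∷ B) ∷ʳ t ≡ (A ∷ʳ w) ++ (B ∷ʳ t)
    reassoc = trans (LP.++-assoc A (w ∷ B) [ t ]) (sym (LP.++-assoc A [ w ] (B ∷ʳ t)))
    Q : Path G
    Q = record
      { src = s ; internal = A ; tgt = w
      ; chain = chain-++⁻ˡ (s ∷ A ∷ʳ w) (subst (λ xs → Chain G (s ∷ xs)) reassoc c)
      ; uniqInit = Unique-++⁻ˡ (s ∷ A) ui
      ; uniqTail = Unique-++⁻ˡ (A ∷ʳ w) (subst Unique reassoc ut) }
    arcs⊆ : pathArcs Q ⊆ arcsOf (s ∷ (A ++ w ∷ B) ∷ʳ t)
    arcs⊆ m = subst (λ xs → _ ∈ arcsOf (s ∷ xs)) (sym reassoc) (arcsOf-++⁺ˡ (s ∷ A ∷ʳ w) m)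

  lastArc : (P : Path G) → ∃ λ u → (u , Path.tgt P) ∈ pathArcs P ×
    (u ≡ Path.src P ⊎ u ∈ Path.internal P × Σ (Path G) λ Q → Path.src Q ≡ Path.src P × Path.tgt Q ≡ u × Q ⊑ P)
  lastArc P@record { src = s ; internal = I ; tgt = t } with initLast I
  ... | [] = s , here refl , inj₁ refl
  ... | A ∷ʳ′ u = u , arc∈ , inj₂ (∈-++⁺ʳ A (here refl) , prefix P refl)
    where
    arc∈ : (u , t) ∈ arcsOf (s ∷ A ∷ʳ u ∷ʳ t)
    arc∈ = subst ((u , t) ∈_) (sym (arcsOf-∷ʳ (s ∷ A) u t)) (∈-++⁺ʳ _ (here refl))

  extend : (P : Path G) {w : Fin n} → Path.src P ≢ Path.tgt P → Arc G (Path.tgt P) w →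
    Σ (Path G) λ Q → Path.src Q ≡ Path.src P × Path.tgt Q ≡ w ×
      pathArcs Q ⊆ (Path.tgt P , w) ∷ pathArcs P × Path.internal Q ⊆ Path.tgt P ∷ Path.internal P
  extend P {w} s≢t tw with w ≟ Path.tgt P
  ... | yes refl = P , refl , refl , there , there
  ... | no w≢t with w ∈? Path.internal P
  ...   | yes w∈I with prefix P (proj₂ (proj₂ (∈-∃++ w∈I)))
  ...     | Q , s≡ , t≡ , arcs⊆ , int⊆ = Q , s≡ , t≡ , there ∘ arcs⊆ , there ∘ int⊆
  extend record { src = s ; internal = I ; tgt = t ; chain = c ; uniqInit = s∉I ∷ _ ; uniqTail = ut }
    {w} s≢t tw | no w≢t | no w∉I = Q , refl , refl , arcs⊆ , ∷ʳ⊆∷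
    where
    w∉I∷ʳt : w ∉ I ∷ʳ t
    w∉I∷ʳt m with ∈-++⁻ I m
    ... | inj₁ w∈I = w∉I w∈I
    ... | inj₂ (here w≡t) = w≢t w≡t
    Q : Path G
    Q = record
      { src = s ; internal = I ∷ʳ t ; tgt = w
      ; chain = chain-∷ʳ (s ∷ I) c tw
      ; uniqInit = AllP.++⁺ s∉I (s≢t ∷ []) ∷ ut
      ; uniqTail = Unique-∷ʳ ut w∉I∷ʳt }
    arcs⊆ : pathArcs Q ⊆ (t , w) ∷ arcsOf (s ∷ I ∷ʳ t)
    arcs⊆ m = ∷ʳ⊆∷ (subst (_ ∈_) (arcsOf-∷ʳ (s ∷ I) t w) m)

flipAt-same : ∀ {n} (x : Config n) u → flipAt x u u ≡ not (x u)
flipAt-same x u with u ≟ u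
... | yes _ = refl
... | no u≢u = ⊥-elim (u≢u refl)

flipAt-other : ∀ {n} (x : Config n) {u w} → w ≢ u → flipAt x u w ≡ x w
flipAt-other x {u} {w} w≢u with w ≟ u
... | yes w≡u = ⊥-elim (w≢u w≡u)
... | no _ = refl

module PackingNetwork {n : ℕ} {G : Digraph n} {k : ℕ} (Pk : Packing G k) where
  open Walks G
  open Packing Pk

  V : Fin k → List (Fin n)
  V i = cycVerts (cyc i)

  Outside : Fin n → Set
  Outside v = ∀ i → v ∉ V i

  cycle-unique : ∀ {v} i j → v ∈ V i → v ∈ V j → i ≡ j
  cycle-unique i j v∈i v∈j with i ≟ j
  ... | yes i≡j = i≡j
  ... | no i≢j = ⊥-elim (disjoint i j i≢j _ v∈i v∈j)

  Principal-⊑ : ∀ {P Q} → Q ⊑ P → Principal Pk P → Principal Pk Q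
  Principal-⊑ (arcs⊆ , int⊆) pr i = (λ a m → proj₁ (pr i) a (arcs⊆ m)) , (λ w m → proj₂ (pr i) w (int⊆ m))

  principal-internal : ∀ {P w} → Principal Pk P → w ∈ Path.internal P → Outside w
  principal-internal pr m i = proj₂ (pr i) _ m

  arcPrincipal : ∀ {u w j} (uw : Arc G u w) → u ∈ V j → w ∉ V j → Principal Pk (arcPath uw)
  arcPrincipal uw u∈j w∉j i = off-cycle , λ _ ()
    where
    off-cycle : ∀ a → a ∈ pathArcs (arcPath uw) → a ∉ cycArcs (cyc i)
    off-cycle a (here refl) a∈i with cycArc-verts (cyc i) a∈i
    ... | u∈i , w∈i rewrite cycle-unique _ _ u∈j u∈i = w∉j w∈i

  -- The continuation stays principal: the only new arc and internal vertex sit at the old end,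
  -- which is outside the packing.
  extendPrincipal : ∀ (P : Path G) {j w} → Principal Pk P → Path.src P ∈ V j → Outside (Path.tgt P) →
    Arc G (Path.tgt P) w → Σ (Path G) λ Q → Principal Pk Q × Path.src Q ≡ Path.src P × Path.tgt Q ≡ w
  extendPrincipal P {j} pr s∈j t-out tw with extend P (λ s≡t → t-out j (subst (_∈ V j) s≡t s∈j)) tw
  ... | Q , s≡ , t≡ , arcs⊆ , int⊆ = Q , prQ , s≡ , t≡
    where
    prQ : Principal Pk Q
    prQ i = off-cycle , internal-out
      where
      off-cycle : ∀ a → a ∈ pathArcs Q → a ∉ cycArcs (cyc i)
      off-cycle a m with arcs⊆ m
      ... | here refl = λ a∈i → t-out i (proj₁ (cycArc-verts (cyc i) a∈i))
      ... | there m′ = proj₁ (pr i) a m′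
      internal-out : ∀ w → w ∈ Path.internal Q → w ∉ V i
      internal-out w m with int⊆ m
      ... | here refl = t-out i
      ... | there m′ = proj₂ (pr i) w m′

  CycleArc : Fin n → Fin n → Set
  CycleArc p v = ∃ λ i → (p , v) ∈ cycArcs (cyc i)

  cyclePred? : ∀ v → Dec (∃ λ p → CycleArc p v)
  cyclePred? v = any? λ p → any? λ i → (p , v) ∈ᵃ? cycArcs (cyc i)
    where open import Data.List.Membership.DecPropositional (≡-dec (_≟_ {n}) _≟_) using () renaming (_∈?_ to _∈ᵃ?_)

  pred-exists : ∀ {i v} → v ∈ V i → ∃ λ p → CycleArc p v
  pred-exists {i} v∈i = Prod.map₂ (i ,_) (cycVerts-pred (cyc i) v∈i)

  cycleArc-arc : ∀ {p v} → CycleArc p v → Arc G p v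
  cycleArc-arc (i , m) = cycArc-arc (cyc i) m

  otherIn : Fin n → Fin n → Fin n → Bool
  otherIn v p w = G w v ∧ not (does (w ≟ p))

  otherIn-true⁺ : ∀ {v p w} → Arc G w v → w ≢ p → otherIn v p w ≡ true
  otherIn-true⁺ {v} {p} {w} wv w≢p = cong₂ _∧_ wv (cong not (dec-false (w ≟ p) w≢p))

  otherIn-true⁻ : ∀ {v p w} → otherIn v p w ≡ true → Arc G w v × w ≢ p
  otherIn-true⁻ {v} {p} {w} e with w ≟ p
  ... | yes _ = ⊥-elim (≢-by e (BP.∧-zeroʳ (G w v)) refl)
  ... | no w≢p = BP.∧-conicalˡ _ _ e , w≢p

  rule : ∀ v → Dec (∃ λ p → CycleArc p v) → Config n → Bool
  rule v (yes (p , _)) x = x p ∨ ⋀[ otherIn v p ] x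
  rule v (no _)        x = ⋀[ (λ w → G w v) ] x

  network : BN n
  network x v = rule v (cyclePred? v) x

  network-mono : Monotone network
  network-mono x y x≤y v with cyclePred? v
  ... | yes (p , _) = ∨-mono (x≤y p) (⋀[]-mono _ x≤y)
  ... | no _ = ⋀[]-mono _ x≤y

  network-source : ∀ {v} → IsSource G v → ∀ x → network x v ≡ false
  network-source {v} src x with cyclePred? v
  ... | yes (p , pv) = ⊥-elim (≢-by (cycleArc-arc pv) (src p) refl)
  ... | no _ = ⋀[]-empty _ src

  network-local : ∀ {x y v} → (∀ w → Arc G w v → x w ≡ y w) → network x v ≡ network y v
  network-local {v = v} agree with cyclePred? v
  ... | yes (p , pv) = cong₂ _∨_ (agree p (cycleArc-arc pv)) (⋀[]-local _ (λ w → agree w ∘ proj₁ ∘ otherIn-true⁻))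
  ... | no _ = ⋀[]-local _ agree

  arc⇒depends : ∀ {u v} → Arc G u v → DependsOn network u v
  arc⇒depends {u} {v} uv with cyclePred? v
  ... | no _ = allOn , ≢-by on off
    where
    allOn : Config n
    allOn _ = true
    on : ⋀[ (λ w → G w v) ] allOn ≡ true
    on = ⋀[]-true⁺ _ u uv (λ _ _ → refl)
    off : ⋀[ (λ w → G w v) ] (flipAt allOn u) ≡ false
    off = ⋀[]-false⁺ _ u uv (flipAt-same allOn u)
  ... | yes (p , _) with u ≟ p
  ...   | yes refl = allOff , (≢-by on off ∘ sym)
    where
    allOff : Config n
    allOff _ = false
    on : flipAt allOff p p ∨ ⋀[ otherIn v p ] (flipAt allOff p) ≡ true
    on = cong (_∨ ⋀[ otherIn v p ] (flipAt allOff p)) (flipAt-same allOff p)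
    off : false ∨ ⋀[ otherIn v p ] allOff ≡ false
    off = ⋀[]-const-false (otherIn v p)
  ...   | no u≢p = allBut , ≢-by on off
    where
    allBut : Config n
    allBut = flipAt (λ _ → true) p
    on : allBut p ∨ ⋀[ otherIn v p ] allBut ≡ true
    on = trans (cong (allBut p ∨_) (⋀[]-true⁺ _ u (otherIn-true⁺ uv u≢p)
              (λ w o → flipAt-other _ (proj₂ (otherIn-true⁻ o))))) (BP.∨-zeroʳ _)
    off : flipAt allBut u p ∨ ⋀[ otherIn v p ] (flipAt allBut u) ≡ false
    off = cong₂ _∨_ (trans (flipAt-other allBut (u≢p ∘ sym)) (flipAt-same _ p))
                    (⋀[]-false⁺ _ u (otherIn-true⁺ uv u≢p)
                      (trans (flipAt-same allBut u) (cong not (flipAt-other _ u≢p))))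

  depends⇒arc : ∀ {u v} → DependsOn network u v → Arc G u v
  depends⇒arc {u} {v} (x , differs) with G u v in uv
  ... | true = refl
  ... | false = ⊥-elim (differs (network-local λ w wv → sym (flipAt-other x λ { refl → ≢-by wv uv refl })))

  network-interaction : HasInteractionGraph network G
  network-interaction u v = mk⇔ arc⇒depends depends⇒arc

  module Selection (special : Special Pk) (S : Fin k → Bool) where
    open import Data.List.Membership.DecPropositional (_≟_ {n}) using (_∈?_)

    Selected : Fin n → Set
    Selected v = ∃ λ i → S i ≡ true × v ∈ V i

    ZeroSource : Fin n → Set
    ZeroSource v = (∃ λ i → S i ≡ false × v ∈ V i) ⊎ IsSource G v

    Fed : Fin n → Set
    Fed w = Σ (Path G) λ P → Principal Pk P × Selected (Path.src P) × Path.tgt P ≡ w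

    selected-unselected : ∀ {i v} → Selected v → S i ≡ false → v ∈ V i → ⊥
    selected-unselected (j , sj , v∈j) si v∈i rewrite cycle-unique j _ v∈j v∈i = ≢-by sj si refl

    feed : ∀ {u w} → Selected u ⊎ (Outside u × Fed u) → Arc G u w → ¬ Selected w → Fed w
    feed (inj₁ sel@(j , sj , u∈j)) uw ¬sel =
      arcPath uw , arcPrincipal uw u∈j (λ w∈j → ¬sel (j , sj , w∈j)) , sel , refl
    feed (inj₂ (u-out , P , pr , sel@(j , _ , s∈j) , refl)) uw _ with extendPrincipal P pr s∈j u-out uw
    ... | Q , prQ , s≡ , t≡ = Q , prQ , subst Selected (sym s≡) sel , t≡

    -- Kept along the iteration from the selected cycles. Its last clause is what lets the
    -- special condition keep the unselected cycles switched off.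
    record Invariant (x : Config n) : Set where
      field
        on⇒fed : ∀ {w} → x w ≡ true → Selected w ⊎ (Outside w × Fed w)
        off-at-zero-sources : ∀ {v} → ZeroSource v → x v ≡ false
        off-downstream : ∀ P → Principal Pk P → ZeroSource (Path.src P) → Outside (Path.tgt P) →
          x (Path.tgt P) ≡ false

    lastOff : ∀ {x} → Invariant x → ∀ P → Principal Pk P → ZeroSource (Path.src P) →
      ∃ λ u → (u , Path.tgt P) ∈ pathArcs P × x u ≡ false
    lastOff inv P pr z with lastArc P
    ... | u , ut , inj₁ refl = u , ut , Invariant.off-at-zero-sources inv z
    ... | u , ut , inj₂ (u∈I , Q , s≡ , refl , Q⊑P) =
      u , ut , Invariant.off-downstream inv Q (Principal-⊑ {P} {Q} Q⊑P pr)
                 (subst ZeroSource (sym s≡) z) (principal-internal {P} pr u∈I)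

    module Step {x : Config n} (inv : Invariant x) where
      open Invariant inv

      cycle-or-source⇒zeroSource : ∀ {i s} → S i ≡ false → s ∈ V i ⊎ IsSource G s → ZeroSource s
      cycle-or-source⇒zeroSource si (inj₁ s∈i) = inj₁ (_ , si , s∈i)
      cycle-or-source⇒zeroSource _ (inj₂ src) = inj₂ src

      -- If all other in-neighbours of v were on, one of them is fed from a selected cycle, so
      -- specialness yields a principal path into v from its own cycle or a source; its last
      -- vertex is off, and it is not the cycle predecessor p because the path is principal.
      others-off : ∀ {i v p} → S i ≡ false → (p , v) ∈ cycArcs (cyc i) → ⋀[ otherIn v p ] x ≡ false
      others-off {i} {v} {p} si pv with proj₂ (cycArc-verts (cyc i) pv) | ⋀[ otherIn v p ] x in allOn
      ... | _ | false = refl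
      ... | v∈i | true with ⋀[]-true⁻ (otherIn v p) allOn
      ...   | (u₀ , u₀∈) , others-on
              with feed (on⇒fed (others-on u₀ u₀∈)) (proj₁ (otherIn-true⁻ u₀∈))
                        (λ sel → selected-unselected sel si v∈i)
      ...     | R , prR , (j , sj , s∈j) , R↦v
              with special i v v∈i
                     (j , (λ { refl → ≢-by sj si refl }) , R , prR , s∈j , R↦v)
      ...       | P , prP , refl , from with lastOff inv P prP (cycle-or-source⇒zeroSource si from)
      ...         | u , uv∈P , xu = ⊥-elim (≢-by (others-on u (otherIn-true⁺ uv u≢p)) xu refl)
        where
        uv : Arc G u (Path.tgt P)
        uv = chain-arc _ (Path.chain P) uv∈P
        u≢p : u ≢ p
        u≢p refl = proj₁ (prP i) _ uv∈P pv

      cycle-rule-off : ∀ {i v p} → S i ≡ false → (p , v) ∈ cycArcs (cyc i) → x p ∨ ⋀[ otherIn v p ] x ≡ false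
      cycle-rule-off {i} si pv =
        cong₂ _∨_ (off-at-zero-sources (inj₁ (i , si , proj₁ (cycArc-verts (cyc i) pv)))) (others-off si pv)

      on⇒fed′ : ∀ {w} → network x w ≡ true → Selected w ⊎ (Outside w × Fed w)
      on⇒fed′ {w} on with cyclePred? w
      ... | yes (p , j , pw) with S j in sj
      ...   | true = inj₁ (j , sj , proj₂ (cycArc-verts (cyc j) pw))
      ...   | false = ⊥-elim (≢-by on (cycle-rule-off sj pw) refl)
      on⇒fed′ {w} on | no none with ⋀[]-true⁻ (λ u → G u w) on
      ... | (u , uw) , in-on = inj₂ (w-out , feed (on⇒fed (in-on u uw)) uw λ (j , _ , w∈j) → w-out j w∈j)
        where
        w-out : Outside w
        w-out i w∈i = none (pred-exists w∈i)

      off-at-zero-sources′ : ∀ {v} → ZeroSource v → network x v ≡ false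
      off-at-zero-sources′ (inj₂ src) = network-source src x
      off-at-zero-sources′ {v} (inj₁ (i , si , v∈i)) with cyclePred? v
      ... | no none = ⊥-elim (none (pred-exists v∈i))
      ... | yes (p , j , pv) with cycle-unique j i (proj₂ (cycArc-verts (cyc j) pv)) v∈i
      ...   | refl = cycle-rule-off si pv

      off-downstream′ : ∀ P → Principal Pk P → ZeroSource (Path.src P) → Outside (Path.tgt P) →
        network x (Path.tgt P) ≡ false
      off-downstream′ P pr z t-out with lastOff inv P pr z | cyclePred? (Path.tgt P)
      ... | _ | yes (_ , j , pt) = ⊥-elim (t-out j (proj₂ (cycArc-verts (cyc j) pt)))
      ... | u , ut∈P , xu | no _ = ⋀[]-false⁺ _ u (chain-arc _ (Path.chain P) ut∈P) xu

      step : Invariant (network x)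
      step = record { on⇒fed = on⇒fed′ ; off-at-zero-sources = off-at-zero-sources′ ; off-downstream = off-downstream′ }

    selected? : ∀ v → Dec (Selected v)
    selected? v = any? λ i → (S i BP.≟ true) ×-dec (v ∈? V i)

    seed : Config n
    seed v = does (selected? v)

    seed-on : ∀ {v} → seed v ≡ true → Selected v
    seed-on {v} on with selected? v
    ... | yes sel = sel

    seed-invariant : Invariant seed
    seed-invariant = record
      { on⇒fed = inj₁ ∘ seed-on
      ; off-at-zero-sources = dec-false (selected? _) ∘ not-selected
      ; off-downstream = λ P _ _ t-out → dec-false (selected? _) λ (j , _ , t∈j) → t-out j t∈j }
      where
      not-selected : ∀ {v} → ZeroSource v → ¬ Selected v
      not-selected (inj₁ (_ , si , v∈i)) sel = selected-unselected sel si v∈i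
      not-selected (inj₂ src) (_ , _ , v∈j) with pred-exists v∈j
      ... | p , pv = ≢-by (cycleArc-arc pv) (src p) refl

    seed≤network : seed ≤ᶜ network seed
    seed≤network v with seed v in on
    ... | false = BP.≤-minimum _
    ... | true with seed-on on | cyclePred? v
    ...   | (j , _ , v∈j) | no none = ⊥-elim (none (pred-exists v∈j))
    ...   | (j , sj , v∈j) | yes (p , j′ , pv) with cycle-unique j′ j (proj₂ (cycArc-verts (cyc j′) pv)) v∈j
    ...     | refl rewrite dec-true (selected? p) (j , sj , proj₁ (cycArc-verts (cyc j) pv)) = b≤b

    open Kleene network network-mono seed≤network

    fixedPoint : Config n
    fixedPoint = fold seed network (suc n)

    fixedPoint-fixed : IsFixedPoint network fixedPoint
    fixedPoint-fixed = iterate-fixed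

    iterate-invariant : ∀ t → Invariant (fold seed network t)
    iterate-invariant zero = seed-invariant
    iterate-invariant (suc t) = Step.step (iterate-invariant t)

    fixedPoint-cycle : ∀ i → fixedPoint (Cycle.start (cyc i)) ≡ S i
    fixedPoint-cycle i with S i in si
    ... | true = ≤-true (iterate-≥ (suc n) _) (dec-true (selected? _) (i , si , here refl))
    ... | false = Invariant.off-at-zero-sources (iterate-invariant (suc n)) (inj₁ (i , si , here refl))

subset : ∀ {k} → Fin (2 ^ k) → Fin k → Bool
subset {k} a i = Inverse.to 2↔Bool (finToFun {2} {k} a i)

funToFin-cong : ∀ {m k} {f g : Fin m → Fin k} → (∀ i → f i ≡ g i) → funToFin f ≡ funToFin g
funToFin-cong {zero} _ = refl
funToFin-cong {suc m} f≗g = cong₂ combine (f≗g zero) (funToFin-cong (f≗g ∘ suc))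

subset-injective : ∀ {k} {a b : Fin (2 ^ k)} → (∀ i → subset a i ≡ subset b i) → a ≡ b
subset-injective {k} {a} {b} same = begin
  a                             ≡⟨ funToFin-finToFin {k} a ⟨
  funToFin (finToFun {2} {k} a) ≡⟨ funToFin-cong {k} (Injection.injective (↔⇒↣ 2↔Bool) ∘ same) ⟩
  funToFin (finToFun {2} {k} b) ≡⟨ funToFin-finToFin {k} b ⟩
  b                             ∎
  where open ≡-Reasoning

special-packing⇒fixedPoints : ∀ {n} {G : Digraph n} {k} (Pk : Packing G k) → Special Pk →
  Σ (BN n) λ f → Monotone f × HasInteractionGraph f G ×
    (∀ v → IsSource G v → ∀ x → f x v ≡ false) × AtLeastFixedPoints f (2 ^ k)
special-packing⇒fixedPoints {n} {G} {k} Pk special =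
  network , network-mono , network-interaction , (λ _ src → network-source src) , y , fixed , distinct
  where
  open PackingNetwork Pk
  y : Fin (2 ^ k) → Config n
  y a = Selection.fixedPoint special (subset {k} a)
  fixed : ∀ a → IsFixedPoint network (y a)
  fixed a = Selection.fixedPoint-fixed special (subset {k} a)
  distinct : ∀ a b → (∀ v → y a v ≡ y b v) → a ≡ b
  distinct a b same = subset-injective {k} λ i →
    trans (sym (Selection.fixedPoint-cycle special (subset {k} a) i))
          (trans (same _) (Selection.fixedPoint-cycle special (subset {k} b) i))

lemma9 : ∀ n (G : Digraph n) (k : ℕ) → IsNuStar G k →
    Σ (BN n) λ f → Monotone f × HasInteractionGraph f G ×
      (∀ v → IsSource G v → ∀ x → f x v ≡ false) ×
      AtLeastFixedPoints f (2 ^ k)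
lemma9 n G k ((Pk , special) , _) = special-packing⇒fixedPoints Pk special
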